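{- For every connected $2$-degenerate graph $G$ on $n \geq 3$ vertices, there is a strongly separating path system $\mathcal{P}$ for $G$ with exactly $n$ paths such that (i) every edge of $G$ lies in exactly two paths of $\mathcal{P}$, and (ii) for every vertex $v$ of $G$, there are exactly two paths in $\mathcal{P}$ having $v$ as an endpoint.
   Context: All graphs are finite and simple. A graph $G$ is $2$-degenerate if every subgraph of $G$ contains a vertex of degree at most $2$. Given a collection $\mathcal{P}$ of paths in a graph $G$, two edges $e,f$ of $G$ are separated by $\mathcal{P}$ if there are paths $P_e,P_f\in\mathcal{P}$ such that $P_e$ contains $e$ but not $f$, and $P_f$ contains $f$ but not $e$. $\mathcal{P}$ is a strongly separating path system of $G$ if it separates every pair of distinct edges of $G$. -}

module Defs where

open import Data.Nat using (ℕ; zero; suc; _+_; _≤_)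
open import Data.Fin using (Fin)
open import Data.Bool using (Bool; true; false; if_then_else_)
open import Data.List using (List; []; _∷_; _∷ʳ_; length; map; allFin)
open import Data.Nat.ListAction using (sum)
open import Data.List.Relation.Unary.Unique.Propositional using (Unique)
open import Data.Product using (Σ; ∃; _×_; _,_)
open import Data.Sum using (_⊎_)
open import Data.Unit using (⊤)
open import Relation.Binary.PropositionalEquality using (_≡_)
open import Relation.Nullary using (¬_)

record SimpleGraph (n : ℕ) : Set where
  field
    adj    : Fin n → Fin n → Bool
    sym    : ∀ u v → adj u v ≡ adj v u
    irrefl : ∀ v → adj v v ≡ false
open SimpleGraph public

module _ {n : ℕ} (G : SimpleGraph n) where

  data Reach : Fin n → Fin n → Set where
    stay : ∀ {u} → Reach u u
    step : ∀ {u w v} → adj G u w ≡ true → Reach w v → Reach u v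

  Connected : Set
  Connected = ∀ u v → Reach u v

  record Subgraph : Set where
    field
      S      : Fin n → Bool
      E      : Fin n → Fin n → Bool
      E-sym  : ∀ u v → E u v ≡ E v u
      E-sub  : ∀ u v → E u v ≡ true → adj G u v ≡ true × S u ≡ true × S v ≡ true
  open Subgraph public

  degIn : Subgraph → Fin n → ℕ
  degIn H v = sum (map (λ w → if E H v w then 1 else 0) (allFin n))

  TwoDegenerate : Set
  TwoDegenerate = (H : Subgraph) → (∃ λ v → S H v ≡ true) →
                  ∃ λ v → S H v ≡ true × degIn H v ≤ 2

  ConsecAdj : List (Fin n) → Set
  ConsecAdj []            = ⊤
  ConsecAdj (x ∷ [])      = ⊤
  ConsecAdj (x ∷ y ∷ xs)  = adj G x y ≡ true × ConsecAdj (y ∷ xs)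

  record Path : Set where
    field
      verts    : List (Fin n)
      nontriv  : 2 ≤ length verts
      distinct : Unique verts
      walk     : ConsecAdj verts
  open Path public

data Consec {n : ℕ} : List (Fin n) → Fin n → Fin n → Set where
  here  : ∀ {a b xs} → Consec (a ∷ b ∷ xs) a b
  there : ∀ {x xs a b} → Consec xs a b → Consec (x ∷ xs) a b

module _ {n : ℕ} {G : SimpleGraph n} where

  EdgeIn : Path G → Fin n → Fin n → Set
  EdgeIn P u v = Consec (verts P) u v ⊎ Consec (verts P) v u

  IsEndpoint : Path G → Fin n → Set
  IsEndpoint P v = (∃ λ xs → verts P ≡ v ∷ xs) ⊎ (∃ λ xs → verts P ≡ xs ∷ʳ v)

SameEdge : {n : ℕ} → Fin n → Fin n → Fin n → Fin n → Set
SameEdge u v u' v' = (u ≡ u' × v ≡ v') ⊎ (u ≡ v' × v ≡ u')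

ExactlyTwo : {m : ℕ} → (Fin m → Set) → Set
ExactlyTwo {m} Q = Σ (Fin m) λ i → Σ (Fin m) λ j →
  ¬ (i ≡ j) × Q i × Q j × (∀ k → Q k → k ≡ i ⊎ k ≡ j)

module _ {n m : ℕ} (G : SimpleGraph n) (𝒫 : Fin m → Path G) where

  StronglySeparating : Set
  StronglySeparating = ∀ u v u' v' → adj G u v ≡ true → adj G u' v' ≡ true →
    ¬ SameEdge u v u' v' →
    (∃ λ i → EdgeIn (𝒫 i) u v × ¬ EdgeIn (𝒫 i) u' v') ×
    (∃ λ j → EdgeIn (𝒫 j) u' v' × ¬ EdgeIn (𝒫 j) u v)

  EveryEdgeInExactlyTwo : Set
  EveryEdgeInExactlyTwo = ∀ u v → adj G u v ≡ true → ExactlyTwo (λ i → EdgeIn (𝒫 i) u v)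

  EveryVertexEndOfExactlyTwo : Set
  EveryVertexEndOfExactlyTwo = ∀ v → ExactlyTwo (λ i → IsEndpoint (𝒫 i) v)

-- Induct on vertex sets p such that the induced subgraph G[p] has no isolated vertex,
-- building ∣ p ∣ paths of G[p] in which every edge lies on exactly two paths, every
-- vertex ends exactly two paths, and any two edges are separated.  By 2-degeneracy
-- G[p] has a vertex of degree at most 2, which yields one of three configurations.
-- Each is deleted, the system for the rest is built, and the configuration restored:
--   * a pendant vertex ℓ whose neighbour c has another neighbour: extend one of the
--     two paths ending at c by cℓ and add the path cℓ;
--   * an isolated edge uv: add the path uv twice;
--   * a vertex v whose neighbours a ≠ b both have other neighbours: extend a path
--     ending at a by av, a different path ending at b by bv, and add the path avb.
-- Deleted vertices lie on no old path, so extended paths are still paths.  A new edge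
-- is separated from every other edge by the new path (av from bv by the path extended
-- by av), and an old edge e from a new edge f by one of the two paths through e that
-- was not extended by f.
{-# OPTIONS --safe #-}
module Submission where

open import Defs renaming (sym to adj-sym)

open import Data.Bool using (true; false; if_then_else_)
import Data.Bool.Properties as Bool
open import Data.Empty using (⊥; ⊥-elim)
open import Data.Fin using (Fin; zero; suc)
open import Data.Fin.Properties using (suc-injective; any?) renaming (_≟_ to _≟ᶠ_)
open import Data.Fin.Subset
  using (Subset; _∈_; _∉_; _⊆_; _⊂_; _-_; ∣_∣; inside; outside; ⊤; Empty)
open import Data.Fin.Subset.Properties
  using ( _∈?_; nonempty?; ∈⊤; x∈p∧x≢y⇒x∈p-y; p─q⊆p; p─⊥≡p; x∈p⇒p-x⊂p; ⊂-trans
        ; Empty-unique; ∣⊥∣≡0; ∣⊤∣≡n)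
open import Data.Fin.Subset.Induction using (⊂-wellFounded)
open import Data.List using (List; []; _∷_; _∷ʳ_; _++_; [_]; reverse; length; map; filter; allFin)
open import Data.List.Properties
  using ( ∷-injective; ∷-injectiveʳ; ∷ʳ-injectiveʳ; reverse-++; unfold-reverse
        ; reverse-involutive; length-reverse)
open import Data.List.Membership.Propositional using () renaming (_∈_ to _∈ˡ_)
open import Data.List.Membership.Propositional.Properties
  using (∈-++⁺ʳ; ∈-filter⁺; ∈-filter⁻; ∈-allFin)
open import Data.List.Relation.Unary.All using ([]; _∷_)
open import Data.List.Relation.Unary.All.Properties using (¬Any⇒All¬; All¬⇒¬Any)
open import Data.List.Relation.Unary.AllPairs using ([]; _∷_)
open import Data.List.Relation.Unary.Any using (here; there)
open import Data.List.Relation.Unary.Any.Properties using (reverse⁻)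
open import Data.List.Relation.Unary.Unique.Propositional using (Unique)
open import Data.List.Relation.Unary.Unique.Propositional.Properties
  using (allFin⁺) renaming (filter⁺ to unique-filter⁺)
open import Data.List.Relation.Binary.Permutation.Propositional using (↭-sym; ↭⇒↭ₛ)
open import Data.List.Relation.Binary.Permutation.Propositional.Properties using (↭-reverse)
import Data.List.Relation.Binary.Permutation.Setoid.Properties as SetoidPermutation
open import Data.Nat using (ℕ; zero; suc; _≤_; s≤s; z≤n)
open import Data.Nat.ListAction using (sum)
open import Data.Nat.Properties using (m≤n⇒m≤1+n)
open import Data.Product using (Σ; ∃; _×_; _,_; proj₁; proj₂; uncurry)
import Data.Product as Product
open import Data.Sum using (_⊎_; inj₁; inj₂)
import Data.Sum as Sum
open import Data.Unit using (tt)
import Data.Vec as Vec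
import Data.Vec.Functional as Vector
open import Data.Vec.Functional.Properties using (updateAt-updates; updateAt-minimal)
open import Function using (_∘_; case_of_)
open import Function.Bundles using (mk⇔)
open import Induction.WellFounded using (WfRec; module All)
open import Relation.Binary.PropositionalEquality
  using (_≡_; _≢_; refl; sym; trans; cong; subst; setoid)
open import Relation.Nullary using (¬_; Dec; yes; no; does)
open import Relation.Nullary.Decidable using (_×-dec_; ¬?; dec-true; does-⇔)
open import Relation.Unary using (Decidable)

module _ {m : ℕ} {Q : Fin m → Set} where

  exactlyTwo-resp : {P : Fin m → Set} → (∀ i → P i → Q i) → (∀ i → Q i → P i) →
                    ExactlyTwo P → ExactlyTwo Q
  exactlyTwo-resp to from (i , j , i≢j , Pi , Pj , only) =
    i , j , i≢j , to i Pi , to j Pj , λ k → only k ∘ from k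

  exactlyTwo-swap : ExactlyTwo Q → ExactlyTwo Q
  exactlyTwo-swap (i , j , i≢j , Qi , Qj , only) =
    j , i , i≢j ∘ sym , Qj , Qi , λ k → Sum.swap ∘ only k

  exactlyTwo-avoiding : (k : Fin m) → ExactlyTwo Q → Σ (ExactlyTwo Q) λ two → proj₁ two ≢ k
  exactlyTwo-avoiding k two@(i , j , i≢j , _) with i ≟ᶠ k
  ... | no i≢k  = two , i≢k
  ... | yes refl = exactlyTwo-swap two , i≢j ∘ sym

  exactlyTwo-escape : {R : Fin m → Set} {k : Fin m} → ExactlyTwo Q → (∀ i → R i → i ≡ k) →
                      ∃ λ i → Q i × ¬ R i
  exactlyTwo-escape {k = k} two R⊆k with exactlyTwo-avoiding k two
  ... | (i , _ , _ , Qi , _) , i≢k = i , Qi , i≢k ∘ R⊆k i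

module _ {m : ℕ} {Q : Fin (suc m) → Set} where

  exactlyTwo-suc : ¬ Q zero → ExactlyTwo (Q ∘ suc) → ExactlyTwo Q
  exactlyTwo-suc ¬Q₀ (i , j , i≢j , Qi , Qj , only) =
    suc i , suc j , i≢j ∘ suc-injective , Qi , Qj , λ where
      zero    Q₀ → ⊥-elim (¬Q₀ Q₀)
      (suc k) Qk → Sum.map (cong suc) (cong suc) (only k Qk)

  exactlyTwo-zero : {j : Fin m} → Q zero → Q (suc j) → (∀ i → Q (suc i) → i ≡ j) → ExactlyTwo Q
  exactlyTwo-zero Q₀ Qj only = zero , suc _ , (λ ()) , Q₀ , Qj , λ where
    zero    _  → inj₁ refl
    (suc k) Qk → inj₂ (cong suc (only k Qk))

data AtMostTwo {A : Set} (P : A → Set) : Set where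
  none : (∀ {y} → ¬ P y) → AtMostTwo P
  one  : ∀ {a} → P a → (∀ {y} → P y → y ≡ a) → AtMostTwo P
  two  : ∀ {a b} → P a → P b → a ≢ b → (∀ {y} → P y → y ≡ a ⊎ y ≡ b) → AtMostTwo P

module _ {A : Set} where

  atMostTwo-resp : {P Q : A → Set} → (∀ {y} → P y → Q y) → (∀ {y} → Q y → P y) →
                   AtMostTwo P → AtMostTwo Q
  atMostTwo-resp to from (none ¬P)            = none (¬P ∘ from)
  atMostTwo-resp to from (one Pa only)        = one (to Pa) (only ∘ from)
  atMostTwo-resp to from (two Pa Pb a≢b only) = two (to Pa) (to Pb) a≢b (only ∘ from)

  atMostTwo-∈ : {xs : List A} → Unique xs → length xs ≤ 2 → AtMostTwo (_∈ˡ xs)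
  atMostTwo-∈ {[]}         _                 _ = none λ ()
  atMostTwo-∈ {_ ∷ []}     _                 _ = one (here refl) λ where (here y≡a) → y≡a
  atMostTwo-∈ {_ ∷ _ ∷ []} ((a≢b ∷ []) ∷ _) _ = two (here refl) (there (here refl)) a≢b λ where
    (here y≡a)         → inj₁ y≡a
    (there (here y≡b)) → inj₂ y≡b
  atMostTwo-∈ {_ ∷ _ ∷ _ ∷ _} _ (s≤s (s≤s ()))

does⇒ : {A : Set} (a? : Dec A) → does a? ≡ true → A
does⇒ (yes a) _  = a
does⇒ (no _)  ()

module _ {A : Set} where

  sum-indicator≡length-filter : {P : A → Set} (P? : Decidable P) (xs : List A) →
                                sum (map (λ x → if does (P? x) then 1 else 0) xs) ≡
                                length (filter P? xs)
  sum-indicator≡length-filter P? []       = refl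
  sum-indicator≡length-filter P? (x ∷ xs) with does (P? x)
  ... | true  = cong suc (sum-indicator≡length-filter P? xs)
  ... | false = sum-indicator≡length-filter P? xs

module _ {n : ℕ} where

  consec-∈ : ∀ {xs} {a b : Fin n} → Consec xs a b → a ∈ˡ xs × b ∈ˡ xs
  consec-∈ here      = here refl , there (here refl)
  consec-∈ (there c) = Product.map there there (consec-∈ c)

  consec-++ˡ : ∀ {xs} {a b : Fin n} ys → Consec xs a b → Consec (xs ++ ys) a b
  consec-++ˡ ys here      = here
  consec-++ˡ ys (there c) = there (consec-++ˡ ys c)

  consec-++ʳ : ∀ xs {ys} {a b : Fin n} → Consec ys a b → Consec (xs ++ ys) a b
  consec-++ʳ []       c = c
  consec-++ʳ (x ∷ xs) c = there (consec-++ʳ xs c)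

  consec-reverse : ∀ {xs} {a b : Fin n} → Consec xs a b → Consec (reverse xs) b a
  consec-reverse {a ∷ b ∷ xs} here =
    subst (λ zs → Consec zs b a) (sym (reverse-++ (a ∷ b ∷ []) xs)) (consec-++ʳ (reverse xs) here)
  consec-reverse {x ∷ xs} (there c) =
    subst (λ zs → Consec zs _ _) (sym (unfold-reverse x xs)) (consec-++ˡ [ x ] (consec-reverse c))

  consec-reverse⁻ : ∀ {xs} {a b : Fin n} → Consec (reverse xs) b a → Consec xs a b
  consec-reverse⁻ {xs} c = subst (λ zs → Consec zs _ _) (reverse-involutive xs) (consec-reverse c)

  unique-∷≡∷ʳ : ∀ {x : Fin n} {xs} ys → Unique (x ∷ xs) → x ∷ xs ≡ ys ∷ʳ x → xs ≡ []
  unique-∷≡∷ʳ []       _           eq = ∷-injectiveʳ eq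
  unique-∷≡∷ʳ (_ ∷ zs) (x∉xs ∷ _) eq =
    ⊥-elim (All¬⇒¬Any x∉xs (subst (_ ∈ˡ_) (sym (∷-injectiveʳ eq)) (∈-++⁺ʳ zs (here refl))))

  reverse-∷ : ∀ {xs ys} {x : Fin n} → xs ≡ x ∷ ys → reverse xs ≡ reverse ys ∷ʳ x
  reverse-∷ {ys = ys} {x} refl = unfold-reverse x ys

  reverse-∷ʳ : ∀ {xs} ys {x : Fin n} → xs ≡ ys ∷ʳ x → reverse xs ≡ x ∷ reverse ys
  reverse-∷ʳ ys refl = reverse-++ ys [ _ ]

  unique-reverse : {xs : List (Fin n)} → Unique xs → Unique (reverse xs)
  unique-reverse {xs} = Unique-resp-↭ (↭⇒↭ₛ (↭-sym (↭-reverse xs)))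
    where open SetoidPermutation (setoid (Fin n)) using (Unique-resp-↭)

sameEdge-sym : ∀ {n} {x y u v : Fin n} → SameEdge x y u v → SameEdge u v x y
sameEdge-sym (inj₁ (refl , refl)) = inj₁ (refl , refl)
sameEdge-sym (inj₂ (refl , refl)) = inj₂ (refl , refl)

sameEdge-trans : ∀ {n} {x y x′ y′ u v : Fin n} →
                 SameEdge x y u v → SameEdge x′ y′ u v → SameEdge x y x′ y′
sameEdge-trans (inj₁ (refl , refl)) (inj₁ (refl , refl)) = inj₁ (refl , refl)
sameEdge-trans (inj₁ (refl , refl)) (inj₂ (refl , refl)) = inj₂ (refl , refl)
sameEdge-trans (inj₂ (refl , refl)) (inj₁ (refl , refl)) = inj₂ (refl , refl)
sameEdge-trans (inj₂ (refl , refl)) (inj₂ (refl , refl)) = inj₁ (refl , refl)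

x∈p∧x∉p-y⇒x≡y : ∀ {n} {p : Subset n} {x y} → x ∈ p → x ∉ p - y → x ≡ y
x∈p∧x∉p-y⇒x≡y {x = x} {y} x∈p x∉p-y with x ≟ᶠ y
... | yes x≡y = x≡y
... | no x≢y  = ⊥-elim (x∉p-y (x∈p∧x≢y⇒x∈p-y x∈p x≢y))

x∉p-x : ∀ {n} {p : Subset n} {x} → x ∉ p - x
x∉p-x {p = _ Vec.∷ _} {zero}  ()
x∉p-x {p = _ Vec.∷ _} {suc x} (Vec.there x∈p-x) = x∉p-x x∈p-x

sameEdge-∉ : ∀ {n} {q : Subset n} {x y u z} → SameEdge x y u z → x ∈ q - z → y ∈ q - z → ⊥
sameEdge-∉ (inj₁ (_ , refl)) _   y∈q-y = x∉p-x y∈q-y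
sameEdge-∉ (inj₂ (refl , _)) x∈q-x _   = x∉p-x x∈q-x

x∈p⇒∣p∣≡1+∣p-x∣ : ∀ {n} {p : Subset n} {x} → x ∈ p → ∣ p ∣ ≡ suc ∣ p - x ∣
x∈p⇒∣p∣≡1+∣p-x∣ {p = inside  Vec.∷ p} {zero}  Vec.here        = cong (suc ∘ ∣_∣) (sym (p─⊥≡p p))
x∈p⇒∣p∣≡1+∣p-x∣ {p = inside  Vec.∷ _} {suc _} (Vec.there x∈p) = cong suc (x∈p⇒∣p∣≡1+∣p-x∣ x∈p)
x∈p⇒∣p∣≡1+∣p-x∣ {p = outside Vec.∷ _} {suc _} (Vec.there x∈p) = x∈p⇒∣p∣≡1+∣p-x∣ x∈p

-- Paths and their extension at an endpoint

module _ {N : ℕ} (G : SimpleGraph N) where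

  private
    V = Fin N

  infix 4 _~_
  _~_ : V → V → Set
  x ~ y = adj G x y ≡ true

  ~-sym : ∀ {x y} → x ~ y → y ~ x
  ~-sym {x} {y} = trans (adj-sym G y x)

  ~-irrefl : ∀ {x y} → x ~ y → x ≢ y
  ~-irrefl {x} x~x refl with trans (sym x~x) (irrefl G x)
  ... | ()

  consecAdj⁻ : ∀ {xs} {a b : V} → ConsecAdj G xs → Consec xs a b → a ~ b
  consecAdj⁻ (a~b , _) here = a~b
  consecAdj⁻ {_ ∷ []} _ (there ())
  consecAdj⁻ {_ ∷ _ ∷ _} (_ , walk) (there c) = consecAdj⁻ walk c

  consecAdj⁺ : ∀ {xs} → (∀ {a b : V} → Consec xs a b → a ~ b) → ConsecAdj G xs
  consecAdj⁺ {[]}         _    = tt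
  consecAdj⁺ {_ ∷ []}     _    = tt
  consecAdj⁺ {_ ∷ _ ∷ _} adjc = adjc here , consecAdj⁺ (adjc ∘ there)

  endpoints-distinct : (P : Path G) {x y : V} {xs ys : List V} →
                       verts P ≡ x ∷ xs → verts P ≡ ys ∷ʳ y → x ≢ y
  endpoints-distinct P {ys = ys} P≡x∷xs P≡ys∷ʳy refl
    with unique-∷≡∷ʳ ys (subst Unique P≡x∷xs (distinct P)) (trans (sym P≡x∷xs) P≡ys∷ʳy)
  ... | refl with subst (λ zs → 2 ≤ length zs) P≡x∷xs (nontriv P)
  ... | s≤s ()

  edgeIn-∈ : ∀ {P : Path G} {x y} → EdgeIn P x y → x ∈ˡ verts P × y ∈ˡ verts P
  edgeIn-∈ (inj₁ c) = consec-∈ c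
  edgeIn-∈ (inj₂ c) = Product.swap (consec-∈ c)

  endpoint-∈ : ∀ {P : Path G} {x} → IsEndpoint P x → x ∈ˡ verts P
  endpoint-∈ (inj₁ (_ , P≡x∷xs))  = subst (_ ∈ˡ_) (sym P≡x∷xs) (here refl)
  endpoint-∈ (inj₂ (ys , P≡ys∷ʳx)) = subst (_ ∈ˡ_) (sym P≡ys∷ʳx) (∈-++⁺ʳ ys (here refl))

  edgeIn-resp : ∀ {P : Path G} {x y u v} → SameEdge x y u v → EdgeIn P u v → EdgeIn P x y
  edgeIn-resp (inj₁ (refl , refl)) = λ e → e
  edgeIn-resp (inj₂ (refl , refl)) = Sum.swap

  reversePath : Path G → Path G
  reversePath P = record
    { verts    = reverse (verts P)
    ; nontriv  = subst (2 ≤_) (sym (length-reverse (verts P))) (nontriv P)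
    ; distinct = unique-reverse (distinct P)
    ; walk     = consecAdj⁺ (λ c → ~-sym (consecAdj⁻ (walk P) (consec-reverse⁻ c)))
    }

  module _ {P : Path G} {x y : V} where

    reversePath-edge⁺ : EdgeIn P x y → EdgeIn (reversePath P) x y
    reversePath-edge⁺ = Sum.swap ∘ Sum.map consec-reverse consec-reverse

    reversePath-edge⁻ : EdgeIn (reversePath P) x y → EdgeIn P x y
    reversePath-edge⁻ = Sum.swap ∘ Sum.map consec-reverse⁻ consec-reverse⁻

  module _ {P : Path G} {x : V} where

    reversePath-end⁺ : IsEndpoint P x → IsEndpoint (reversePath P) x
    reversePath-end⁺ (inj₁ (ys , P≡x∷ys))  = inj₂ (reverse ys , reverse-∷ P≡x∷ys)
    reversePath-end⁺ (inj₂ (ys , P≡ys∷ʳx)) = inj₁ (reverse ys , reverse-∷ʳ ys P≡ys∷ʳx)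

    reversePath-end⁻ : IsEndpoint (reversePath P) x → IsEndpoint P x
    reversePath-end⁻ (inj₁ (ys , rP≡x∷ys)) =
      inj₂ (reverse ys , trans P≡rrP (reverse-∷ rP≡x∷ys))
      where P≡rrP = sym (reverse-involutive (verts P))
    reversePath-end⁻ (inj₂ (ys , rP≡ys∷ʳx)) =
      inj₁ (reverse ys , trans P≡rrP (reverse-∷ʳ ys rP≡ys∷ʳx))
      where P≡rrP = sym (reverse-involutive (verts P))

    reversePath-verts⁻ : x ∈ˡ verts (reversePath P) → x ∈ˡ verts P
    reversePath-verts⁻ = reverse⁻

  module Prepend (P : Path G) {u v : V} {xs : List V}
                 (P≡u∷xs : verts P ≡ u ∷ xs) (v~u : v ~ u) (v∉P : ¬ v ∈ˡ verts P) where

    prepend : Path G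
    prepend = record
      { verts    = v ∷ verts P
      ; nontriv  = m≤n⇒m≤1+n (nontriv P)
      ; distinct = ¬Any⇒All¬ _ v∉P ∷ distinct P
      ; walk     = subst (λ zs → ConsecAdj G (v ∷ zs)) (sym P≡u∷xs)
                         (v~u , subst (ConsecAdj G) P≡u∷xs (walk P))
      }

    private
      consec-∷⁻ : ∀ {L} {a b : V} → L ≡ u ∷ xs → Consec (v ∷ L) a b →
                  (a ≡ v × b ≡ u) ⊎ Consec L a b
      consec-∷⁻ refl here      = inj₁ (refl , refl)
      consec-∷⁻ _    (there c) = inj₂ c

    edge⁻ : ∀ {x y} → EdgeIn prepend x y → EdgeIn P x y ⊎ SameEdge x y u v
    edge⁻ (inj₁ c) with consec-∷⁻ P≡u∷xs c
    ... | inj₁ (x≡v , y≡u) = inj₂ (inj₂ (x≡v , y≡u))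
    ... | inj₂ c′          = inj₁ (inj₁ c′)
    edge⁻ (inj₂ c) with consec-∷⁻ P≡u∷xs c
    ... | inj₁ (y≡v , x≡u) = inj₂ (inj₁ (x≡u , y≡v))
    ... | inj₂ c′          = inj₁ (inj₂ c′)

    edge⁺ : ∀ {x y} → EdgeIn P x y → EdgeIn prepend x y
    edge⁺ = Sum.map there there

    newEdge : EdgeIn prepend u v
    newEdge = inj₂ (subst (λ zs → Consec (v ∷ zs) v u) (sym P≡u∷xs) here)

    end⁻ : ∀ {x} → IsEndpoint prepend x → x ≡ v ⊎ (IsEndpoint P x × x ≢ u)
    end⁻ (inj₁ (_ , eq))       = inj₁ (sym (proj₁ (∷-injective eq)))
    end⁻ (inj₂ ([] , eq)) with trans (sym (∷-injectiveʳ eq)) P≡u∷xs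
    ... | ()
    end⁻ (inj₂ (_ ∷ ys , eq)) =
      inj₂ (inj₂ (ys , P≡ys∷ʳx) , λ x≡u → endpoints-distinct P P≡u∷xs P≡ys∷ʳx (sym x≡u))
      where P≡ys∷ʳx = ∷-injectiveʳ eq

    end⁺ : ∀ {x} → IsEndpoint P x → x ≢ u → IsEndpoint prepend x
    end⁺ (inj₁ (_ , P≡x∷ys))  x≢u = ⊥-elim (x≢u (proj₁ (∷-injective (trans (sym P≡x∷ys) P≡u∷xs))))
    end⁺ (inj₂ (ys , P≡ys∷ʳx)) _   = inj₂ (v ∷ ys , cong (v ∷_) P≡ys∷ʳx)

    newEnd : IsEndpoint prepend v
    newEnd = inj₁ (verts P , refl)

    verts⁻ : ∀ {x} → x ∈ˡ verts prepend → x ≡ v ⊎ x ∈ˡ verts P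
    verts⁻ (here x≡v)  = inj₁ x≡v
    verts⁻ (there x∈P) = inj₂ x∈P

  module Extension (P : Path G) {u v : V} (u~v : u ~ v) (v∉P : ¬ v ∈ˡ verts P) where

    private
      module Back {ys : List V} (P≡ys∷ʳu : verts P ≡ ys ∷ʳ u) =
        Prepend (reversePath P) (reverse-∷ʳ ys P≡ys∷ʳu) (~-sym u~v)
                (λ v∈ → v∉P (reversePath-verts⁻ {P = P} v∈))
      module Front {xs : List V} (P≡u∷xs : verts P ≡ u ∷ xs) =
        Prepend P P≡u∷xs (~-sym u~v) v∉P

    extend : IsEndpoint P u → Path G
    extend (inj₁ (_ , P≡u∷xs))  = Front.prepend P≡u∷xs
    extend (inj₂ (_ , P≡ys∷ʳu)) = Back.prepend P≡ys∷ʳu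

    extend-edge⁻ : ∀ end {x y} → EdgeIn (extend end) x y → EdgeIn P x y ⊎ SameEdge x y u v
    extend-edge⁻ (inj₁ (_ , eq)) = Front.edge⁻ eq
    extend-edge⁻ (inj₂ (_ , eq)) = Sum.map₁ (reversePath-edge⁻ {P = P}) ∘ Back.edge⁻ eq

    extend-edge⁺ : ∀ end {x y} → EdgeIn P x y → EdgeIn (extend end) x y
    extend-edge⁺ (inj₁ (_ , eq)) = Front.edge⁺ eq
    extend-edge⁺ (inj₂ (_ , eq)) = Back.edge⁺ eq ∘ reversePath-edge⁺ {P = P}

    extend-newEdge : ∀ end → EdgeIn (extend end) u v
    extend-newEdge (inj₁ (_ , eq)) = Front.newEdge eq
    extend-newEdge (inj₂ (_ , eq)) = Back.newEdge eq

    extend-end⁻ : ∀ end {x} → IsEndpoint (extend end) x → x ≡ v ⊎ (IsEndpoint P x × x ≢ u)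
    extend-end⁻ (inj₁ (_ , eq)) = Front.end⁻ eq
    extend-end⁻ (inj₂ (_ , eq)) = Sum.map₂ (Product.map₁ (reversePath-end⁻ {P = P})) ∘ Back.end⁻ eq

    extend-end⁺ : ∀ end {x} → IsEndpoint P x → x ≢ u → IsEndpoint (extend end) x
    extend-end⁺ (inj₁ (_ , eq)) = Front.end⁺ eq
    extend-end⁺ (inj₂ (_ , eq)) = λ e → Back.end⁺ eq (reversePath-end⁺ {P = P} e)

    extend-newEnd : ∀ end → IsEndpoint (extend end) v
    extend-newEnd (inj₁ (_ , eq)) = Front.newEnd eq
    extend-newEnd (inj₂ (_ , eq)) = Back.newEnd eq

    extend-verts⁻ : ∀ end {x} → x ∈ˡ verts (extend end) → x ≡ v ⊎ x ∈ˡ verts P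
    extend-verts⁻ (inj₁ (_ , eq)) = Front.verts⁻ eq
    extend-verts⁻ (inj₂ (_ , eq)) = Sum.map₂ (reversePath-verts⁻ {P = P}) ∘ Back.verts⁻ eq

  module ExtendAt {m : ℕ} (𝒫 : Fin m → Path G) (j : Fin m) {u v : V}
                  (end : IsEndpoint (𝒫 j) u) (u~v : u ~ v) (v∉ : ¬ v ∈ˡ verts (𝒫 j)) where

    open Extension (𝒫 j) u~v v∉

    extendAt : Fin m → Path G
    extendAt = Vector.updateAt 𝒫 j (λ _ → extend end)

    private
      at-j : extendAt j ≡ extend end
      at-j = updateAt-updates j 𝒫

      elsewhere : ∀ {i} → i ≢ j → extendAt i ≡ 𝒫 i
      elsewhere {i} i≢j = updateAt-minimal i j 𝒫 i≢j

    extendAt-edge⁻ : ∀ i {x y} → EdgeIn (extendAt i) x y →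
                     EdgeIn (𝒫 i) x y ⊎ (i ≡ j × SameEdge x y u v)
    extendAt-edge⁻ i with i ≟ᶠ j
    ... | yes refl rewrite at-j          = Sum.map₂ (refl ,_) ∘ extend-edge⁻ end
    ... | no i≢j   rewrite elsewhere i≢j = inj₁

    extendAt-edge⁺ : ∀ i {x y} → EdgeIn (𝒫 i) x y → EdgeIn (extendAt i) x y
    extendAt-edge⁺ i with i ≟ᶠ j
    ... | yes refl rewrite at-j          = extend-edge⁺ end
    ... | no i≢j   rewrite elsewhere i≢j = λ e → e

    extendAt-newEdge : EdgeIn (extendAt j) u v
    extendAt-newEdge rewrite at-j = extend-newEdge end

    extendAt-end⁻ : ∀ i {x} → IsEndpoint (extendAt i) x →
                    (i ≡ j × x ≡ v) ⊎ (IsEndpoint (𝒫 i) x × ¬ (i ≡ j × x ≡ u))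
    extendAt-end⁻ i with i ≟ᶠ j
    ... | yes refl rewrite at-j =
      Sum.map (refl ,_) (Product.map₂ (λ x≢u (_ , x≡u) → x≢u x≡u)) ∘ extend-end⁻ end
    ... | no i≢j rewrite elsewhere i≢j = λ e → inj₂ (e , i≢j ∘ proj₁)

    extendAt-end⁺ : ∀ i {x} → IsEndpoint (𝒫 i) x → ¬ (i ≡ j × x ≡ u) → IsEndpoint (extendAt i) x
    extendAt-end⁺ i with i ≟ᶠ j
    ... | yes refl rewrite at-j          = λ e ¬j×u → extend-end⁺ end e (¬j×u ∘ (refl ,_))
    ... | no i≢j   rewrite elsewhere i≢j = λ e _ → e

    extendAt-newEnd : IsEndpoint (extendAt j) v
    extendAt-newEnd rewrite at-j = extend-newEnd end

    extendAt-verts⁻ : ∀ i {x} → x ∈ˡ verts (extendAt i) → (i ≡ j × x ≡ v) ⊎ x ∈ˡ verts (𝒫 i)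
    extendAt-verts⁻ i with i ≟ᶠ j
    ... | yes refl rewrite at-j          = Sum.map₁ (refl ,_) ∘ extend-verts⁻ end
    ... | no i≢j   rewrite elsewhere i≢j = inj₂

  module _ {x y : V} (x~y : x ~ y) where

    edgePath : Path G
    edgePath = record
      { verts = x ∷ y ∷ [] ; nontriv = s≤s (s≤s z≤n)
      ; distinct = (~-irrefl x~y ∷ []) ∷ [] ∷ [] ; walk = x~y , tt }

    edgePath-edge : EdgeIn edgePath x y
    edgePath-edge = inj₁ here

    edgePath-edge⁻ : ∀ {a b} → EdgeIn edgePath a b → SameEdge a b x y
    edgePath-edge⁻ (inj₁ here)              = inj₁ (refl , refl)
    edgePath-edge⁻ (inj₂ here)              = inj₂ (refl , refl)
    edgePath-edge⁻ (inj₁ (there (there ())))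
    edgePath-edge⁻ (inj₂ (there (there ())))

    edgePath-separates : ∀ {a b a′ b′} → SameEdge a b x y → ¬ SameEdge a b a′ b′ →
                         EdgeIn edgePath a b × ¬ EdgeIn edgePath a′ b′
    edgePath-separates se e≢f =
      edgeIn-resp {P = edgePath} se edgePath-edge ,
      λ f₀ → e≢f (sameEdge-trans se (edgePath-edge⁻ f₀))

    edgePath-start : IsEndpoint edgePath x
    edgePath-start = inj₁ (_ , refl)

    edgePath-finish : IsEndpoint edgePath y
    edgePath-finish = inj₂ (x ∷ [] , refl)

    edgePath-end⁻ : ∀ {z} → IsEndpoint edgePath z → z ≡ x ⊎ z ≡ y
    edgePath-end⁻ (inj₁ (_ , eq))  = inj₁ (sym (proj₁ (∷-injective eq)))
    edgePath-end⁻ (inj₂ (ys , eq)) = inj₂ (sym (∷ʳ-injectiveʳ (x ∷ []) ys eq))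

    edgePath-verts⁻ : ∀ {z} → z ∈ˡ verts edgePath → z ≡ x ⊎ z ≡ y
    edgePath-verts⁻ (here z≡x)         = inj₁ z≡x
    edgePath-verts⁻ (there (here z≡y)) = inj₂ z≡y

  module _ {a v b : V} (a~v : a ~ v) (v~b : v ~ b) (a≢b : a ≢ b) where

    twoEdgePath : Path G
    twoEdgePath = record
      { verts = a ∷ v ∷ b ∷ [] ; nontriv = s≤s (s≤s z≤n)
      ; distinct = (~-irrefl a~v ∷ a≢b ∷ []) ∷ (~-irrefl v~b ∷ []) ∷ [] ∷ []
      ; walk = a~v , v~b , tt }

    twoEdgePath-edgeˡ : EdgeIn twoEdgePath a v
    twoEdgePath-edgeˡ = inj₁ here

    twoEdgePath-edgeʳ : EdgeIn twoEdgePath b v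
    twoEdgePath-edgeʳ = inj₂ (there here)

    twoEdgePath-edge⁻ : ∀ {x y} → EdgeIn twoEdgePath x y → SameEdge x y a v ⊎ SameEdge x y b v
    twoEdgePath-edge⁻ (inj₁ here)                      = inj₁ (inj₁ (refl , refl))
    twoEdgePath-edge⁻ (inj₂ here)                      = inj₁ (inj₂ (refl , refl))
    twoEdgePath-edge⁻ (inj₁ (there here))              = inj₂ (inj₂ (refl , refl))
    twoEdgePath-edge⁻ (inj₂ (there here))              = inj₂ (inj₁ (refl , refl))
    twoEdgePath-edge⁻ (inj₁ (there (there (there ()))))
    twoEdgePath-edge⁻ (inj₂ (there (there (there ()))))

    twoEdgePath-start : IsEndpoint twoEdgePath a
    twoEdgePath-start = inj₁ (_ , refl)

    twoEdgePath-finish : IsEndpoint twoEdgePath b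
    twoEdgePath-finish = inj₂ (a ∷ v ∷ [] , refl)

    twoEdgePath-end⁻ : ∀ {z} → IsEndpoint twoEdgePath z → z ≡ a ⊎ z ≡ b
    twoEdgePath-end⁻ (inj₁ (_ , eq))  = inj₁ (sym (proj₁ (∷-injective eq)))
    twoEdgePath-end⁻ (inj₂ (ys , eq)) = inj₂ (sym (∷ʳ-injectiveʳ (a ∷ v ∷ []) ys eq))

    twoEdgePath-verts⁻ : ∀ {z} → z ∈ˡ verts twoEdgePath → z ≡ a ⊎ z ≡ v ⊎ z ≡ b
    twoEdgePath-verts⁻ (here z≡a)                 = inj₁ z≡a
    twoEdgePath-verts⁻ (there (here z≡v))         = inj₂ (inj₁ z≡v)
    twoEdgePath-verts⁻ (there (there (here z≡b))) = inj₂ (inj₂ z≡b)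

  -- Induced subgraphs and reducible configurations

  InducedEdge : Subset N → V → V → Set
  InducedEdge p x y = x ∈ p × y ∈ p × x ~ y

  inducedEdge-sym : ∀ {p x y} → InducedEdge p x y → InducedEdge p y x
  inducedEdge-sym (x∈p , y∈p , x~y) = y∈p , x∈p , ~-sym x~y

  inducedEdge-split : ∀ {p x y} z → InducedEdge p x y →
                      (x ≡ z ⊎ y ≡ z) ⊎ InducedEdge (p - z) x y
  inducedEdge-split {x = x} {y} z (x∈p , y∈p , x~y) with x ≟ᶠ z | y ≟ᶠ z
  ... | yes x≡z | _       = inj₁ (inj₁ x≡z)
  ... | no _    | yes y≡z = inj₁ (inj₂ y≡z)
  ... | no x≢z  | no y≢z  = inj₂ (x∈p∧x≢y⇒x∈p-y x∈p x≢z , x∈p∧x≢y⇒x∈p-y y∈p y≢z , x~y)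

  inducedEdge-⊆ : ∀ {p q : Subset N} {x y} → q ⊆ p → InducedEdge q x y → InducedEdge p x y
  inducedEdge-⊆ q⊆p (x∈q , y∈q , x~y) = q⊆p x∈q , q⊆p y∈q , x~y

  inducedEdge? : ∀ p x y → Dec (InducedEdge p x y)
  inducedEdge? p x y = x ∈? p ×-dec y ∈? p ×-dec adj G x y Bool.≟ true

  induced : Subset N → Subgraph G
  induced p = record
    { S     = λ x → does (x ∈? p)
    ; E     = λ x y → does (inducedEdge? p x y)
    ; E-sym = λ x y → does-⇔ (mk⇔ inducedEdge-sym inducedEdge-sym)
                             (inducedEdge? p x y) (inducedEdge? p y x)
    ; E-sub = induced-edge⊆
    }
    where
    induced-edge⊆ : ∀ x y → does (inducedEdge? p x y) ≡ true →
                    adj G x y ≡ true × does (x ∈? p) ≡ true × does (y ∈? p) ≡ true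
    induced-edge⊆ x y eq with does⇒ (inducedEdge? p x y) eq
    ... | x∈p , y∈p , x~y = x~y , dec-true (x ∈? p) x∈p , dec-true (y ∈? p) y∈p

  neighbours : Subset N → V → List V
  neighbours p x = filter (inducedEdge? p x) (allFin N)

  ∈-neighbours⁻ : ∀ {p x y} → y ∈ˡ neighbours p x → InducedEdge p x y
  ∈-neighbours⁻ {p} {x} = proj₂ ∘ ∈-filter⁻ (inducedEdge? p x) {xs = allFin N}

  ∈-neighbours⁺ : ∀ {p x y} → InducedEdge p x y → y ∈ˡ neighbours p x
  ∈-neighbours⁺ {p} {x} = ∈-filter⁺ (inducedEdge? p x) (∈-allFin _)

  degIn-induced : ∀ p x → degIn G (induced p) x ≡ length (neighbours p x)
  degIn-induced p x = sum-indicator≡length-filter (inducedEdge? p x) (allFin N)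

  lowDegreeVertex : TwoDegenerate G → ∀ {p x} → x ∈ p → ∃ λ v → v ∈ p × AtMostTwo (InducedEdge p v)
  lowDegreeVertex twoDeg {p} {x} x∈p with twoDeg (induced p) (x , dec-true (x ∈? p) x∈p)
  ... | v , v∈ , deg≤2 = v , does⇒ (v ∈? p) v∈ , atMostTwo-resp ∈-neighbours⁻ ∈-neighbours⁺ nbrs≤2
    where
    nbrs≤2 : AtMostTwo (_∈ˡ neighbours p v)
    nbrs≤2 = atMostTwo-∈ (unique-filter⁺ (inducedEdge? p v) (allFin⁺ N))
                         (subst (_≤ 2) (degIn-induced p v) deg≤2)

  NoIsolated : Subset N → Set
  NoIsolated p = ∀ {x} → x ∈ p → ∃ λ y → InducedEdge p x y

  OnlyNeighbour : Subset N → V → V → Set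
  OnlyNeighbour p x v = ∀ {y} → InducedEdge p x y → y ≡ v

  OtherNeighbour : Subset N → V → V → Set
  OtherNeighbour p x v = ∃ λ w → InducedEdge p x w × w ≢ v

  otherNeighbour? : ∀ p x v → Dec (OtherNeighbour p x v)
  otherNeighbour? p x v = any? λ w → inducedEdge? p x w ×-dec ¬? (w ≟ᶠ v)

  ¬other⇒only : ∀ {p x v} → ¬ OtherNeighbour p x v → OnlyNeighbour p x v
  ¬other⇒only {v = v} ¬other {y} e with y ≟ᶠ v
  ... | yes y≡v = y≡v
  ... | no y≢v  = ⊥-elim (¬other (y , e , y≢v))

  data Reducible (p : Subset N) : Set where
    pendant      : ∀ {c ℓ} → InducedEdge p c ℓ → OnlyNeighbour p ℓ c → OtherNeighbour p c ℓ →
                   Reducible p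
    isolatedEdge : ∀ {u v} → InducedEdge p u v → OnlyNeighbour p u v → OnlyNeighbour p v u →
                   Reducible p
    suppressible : ∀ {v a b} → InducedEdge p v a → InducedEdge p v b → a ≢ b →
                   (∀ {y} → InducedEdge p v y → y ≡ a ⊎ y ≡ b) →
                   OtherNeighbour p a v → OtherNeighbour p b v → Reducible p

  reducible : ∀ {p v} → NoIsolated p → v ∈ p → AtMostTwo (InducedEdge p v) → Reducible p
  reducible noIso v∈p (none ¬e) = ⊥-elim (¬e (proj₂ (noIso v∈p)))
  reducible {p} {v} _ _ (one {a} va only-v) with otherNeighbour? p a v
  ... | yes other = pendant (inducedEdge-sym va) only-v other
  ... | no ¬other = isolatedEdge va only-v (¬other⇒only ¬other)
  reducible {p} {v} _ _ (two {a} {b} va vb a≢b nbrs-v)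
    with otherNeighbour? p a v | otherNeighbour? p b v
  ... | no ¬other | _         = pendant va (¬other⇒only ¬other) (b , vb , a≢b ∘ sym)
  ... | yes _     | no ¬other = pendant vb (¬other⇒only ¬other) (a , va , a≢b)
  ... | yes oa    | yes ob    = suppressible va vb a≢b nbrs-v oa ob

  noIsolated-⊆ : ∀ {p q} → NoIsolated p → q ⊆ p →
                 (∀ {x y} → x ∈ q → InducedEdge p x y → y ∉ q → ∃ λ w → InducedEdge q x w) →
                 NoIsolated q
  noIsolated-⊆ {q = q} noIso q⊆p rescue {x} x∈q with noIso (q⊆p x∈q)
  ... | y , e@(_ , y∈p , x~y) with y ∈? q
  ...   | yes y∈q = y , x∈q , y∈q , x~y
  ...   | no y∉q  = rescue x∈q e y∉q

  noIsolated-delete : ∀ {p z} → NoIsolated p →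
                      (∀ {x} → x ∈ p - z → InducedEdge p x z → ∃ λ w → InducedEdge (p - z) x w) →
                      NoIsolated (p - z)
  noIsolated-delete noIso rescue = noIsolated-⊆ noIso (p─q⊆p _ _) λ x∈ e y∉ →
    rescue x∈ (subst (InducedEdge _ _) (x∈p∧x∉p-y⇒x≡y (proj₁ (proj₂ e)) y∉) e)

  otherNeighbour⇒edge : ∀ {p x z} → OtherNeighbour p x z → x ∈ p - z →
                        ∃ λ w → InducedEdge (p - z) x w
  otherNeighbour⇒edge (w , (_ , w∈p , x~w) , w≢z) x∈ = w , x∈ , x∈p∧x≢y⇒x∈p-y w∈p w≢z , x~w

  noIsolated-pendant : ∀ {p c ℓ} → NoIsolated p → OnlyNeighbour p ℓ c → OtherNeighbour p c ℓ →
                       NoIsolated (p - ℓ)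
  noIsolated-pendant noIso only-ℓ other = noIsolated-delete noIso λ x∈ xℓ →
    case only-ℓ (inducedEdge-sym xℓ) of λ where
      refl → otherNeighbour⇒edge other x∈

  noIsolated-suppress : ∀ {p v a b} → NoIsolated p → (∀ {y} → InducedEdge p v y → y ≡ a ⊎ y ≡ b) →
                        OtherNeighbour p a v → OtherNeighbour p b v → NoIsolated (p - v)
  noIsolated-suppress noIso nbrs-v oa ob = noIsolated-delete noIso λ x∈ xv →
    case nbrs-v (inducedEdge-sym xv) of λ where
      (inj₁ refl) → otherNeighbour⇒edge oa x∈
      (inj₂ refl) → otherNeighbour⇒edge ob x∈

  noIsolated-isolatedEdge : ∀ {p u v} → NoIsolated p → OnlyNeighbour p u v → OnlyNeighbour p v u →
                            NoIsolated (p - u - v)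
  noIsolated-isolatedEdge {p} {u} {v} noIso only-u only-v =
    noIsolated-⊆ noIso (p─q⊆p _ _ ∘ p─q⊆p _ _) λ {x} {y} x∈ e y∉ → case y ≟ᶠ u of λ where
      (yes refl) → ⊥-elim (x∉p-x (subst (_∈ p - u - v) (only-u (inducedEdge-sym e)) x∈))
      (no y≢u)   → case x∈p∧x∉p-y⇒x≡y (x∈p∧x≢y⇒x∈p-y (proj₁ (proj₂ e)) y≢u) y∉ of λ where
        refl → ⊥-elim (x∉p-x (subst (_∈ p - u) (only-v (inducedEdge-sym e)) (p─q⊆p _ _ x∈)))

  -- Path systems of induced subgraphs

  record IsPathSystem (p : Subset N) {m : ℕ} (𝒫 : Fin m → Path G) : Set where
    field
      verts⊆    : ∀ i {x} → x ∈ˡ verts (𝒫 i) → x ∈ p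
      edgeTwice : ∀ {x y} → InducedEdge p x y → ExactlyTwo (λ i → EdgeIn (𝒫 i) x y)
      endTwice  : ∀ {x} → x ∈ p → ExactlyTwo (λ i → IsEndpoint (𝒫 i) x)
      separates : ∀ {x y x′ y′} → InducedEdge p x y → InducedEdge p x′ y′ → ¬ SameEdge x y x′ y′ →
                  ∃ λ i → EdgeIn (𝒫 i) x y × ¬ EdgeIn (𝒫 i) x′ y′

    avoids : ∀ i {x} → x ∉ p → ¬ x ∈ˡ verts (𝒫 i)
    avoids i x∉p = x∉p ∘ verts⊆ i

    edge⊆ : ∀ i {x y} → EdgeIn (𝒫 i) x y → x ∈ p × y ∈ p
    edge⊆ i = Product.map (verts⊆ i) (verts⊆ i) ∘ edgeIn-∈ {P = 𝒫 i}

  PathSystem : Subset N → ℕ → Set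
  PathSystem p m = Σ (Fin m → Path G) (IsPathSystem p)

  noPaths : ∀ {p} → Empty p → PathSystem p 0
  noPaths empty = (λ ()) , record
    { verts⊆    = λ ()
    ; edgeTwice = λ (x∈p , _) → ⊥-elim (empty (_ , x∈p))
    ; endTwice  = λ x∈p → ⊥-elim (empty (_ , x∈p))
    ; separates = λ (x∈p , _) _ _ → ⊥-elim (empty (_ , x∈p))
    }

  module Pendant {p : Subset N} {c ℓ : V} (cℓ : InducedEdge p c ℓ) (only-ℓ : OnlyNeighbour p ℓ c)
                 {m : ℕ} {𝒫 : Fin m → Path G} (sys : IsPathSystem (p - ℓ) 𝒫)
                 {i₁ i₂ : Fin m} (i₁≢i₂ : i₁ ≢ i₂)
                 (end₁ : IsEndpoint (𝒫 i₁) c) (end₂ : IsEndpoint (𝒫 i₂) c)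
                 (ends-c : ∀ i → IsEndpoint (𝒫 i) c → i ≡ i₁ ⊎ i ≡ i₂) where

    private
      module Old = IsPathSystem sys
      c∈p = proj₁ cℓ
      ℓ∈p = proj₁ (proj₂ cℓ)
      c~ℓ = proj₂ (proj₂ cℓ)
      P₀ = edgePath c~ℓ
    open ExtendAt 𝒫 i₁ end₁ c~ℓ (Old.avoids i₁ x∉p-x)

    family : Fin (suc m) → Path G
    family = P₀ Vector.∷ extendAt

    private
      c≢ℓ : c ≢ ℓ
      c≢ℓ = ~-irrefl c~ℓ

      classify : ∀ {x y} → InducedEdge p x y → SameEdge x y c ℓ ⊎ InducedEdge (p - ℓ) x y
      classify e with inducedEdge-split ℓ e
      ... | inj₁ (inj₁ refl) = inj₁ (inj₂ (refl , only-ℓ e))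
      ... | inj₁ (inj₂ refl) = inj₁ (inj₁ (only-ℓ (inducedEdge-sym e) , refl))
      ... | inj₂ old         = inj₂ old

      old-edge⁻ : ∀ {x y} → InducedEdge (p - ℓ) x y →
                  ∀ i → EdgeIn (extendAt i) x y → EdgeIn (𝒫 i) x y
      old-edge⁻ (x∈ , y∈ , _) i e with extendAt-edge⁻ i e
      ... | inj₁ e′       = e′
      ... | inj₂ (_ , se) = ⊥-elim (sameEdge-∉ se x∈ y∈)

      cℓ-only : ∀ {x y} → SameEdge x y c ℓ → ∀ i → EdgeIn (extendAt i) x y → i ≡ i₁
      cℓ-only se i e with extendAt-edge⁻ i e
      ... | inj₁ e′         = ⊥-elim (uncurry (sameEdge-∉ se) (Old.edge⊆ i e′))
      ... | inj₂ (i≡i₁ , _) = i≡i₁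

      old-edgeTwice : ∀ {x y} → InducedEdge (p - ℓ) x y →
                      ExactlyTwo (λ i → EdgeIn (extendAt i) x y)
      old-edgeTwice e = exactlyTwo-resp (λ i → extendAt-edge⁺ i) (old-edge⁻ e) (Old.edgeTwice e)

    verts⊆ : ∀ i {x} → x ∈ˡ verts (family i) → x ∈ p
    verts⊆ zero x∈ with edgePath-verts⁻ c~ℓ x∈
    ... | inj₁ refl = c∈p
    ... | inj₂ refl = ℓ∈p
    verts⊆ (suc i) x∈ with extendAt-verts⁻ i x∈
    ... | inj₁ (_ , refl) = ℓ∈p
    ... | inj₂ x∈𝒫ᵢ       = p─q⊆p p _ (Old.verts⊆ i x∈𝒫ᵢ)

    edgeTwice : ∀ {x y} → InducedEdge p x y → ExactlyTwo (λ i → EdgeIn (family i) x y)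
    edgeTwice e with classify e
    ... | inj₁ se = exactlyTwo-zero (edgeIn-resp {P = P₀} se (edgePath-edge c~ℓ))
                                    (edgeIn-resp {P = extendAt i₁} se extendAt-newEdge) (cℓ-only se)
    ... | inj₂ old@(x∈ , y∈ , _) =
      exactlyTwo-suc (λ e₀ → sameEdge-∉ (edgePath-edge⁻ c~ℓ e₀) x∈ y∈) (old-edgeTwice old)

    endTwice : ∀ {x} → x ∈ p → ExactlyTwo (λ i → IsEndpoint (family i) x)
    endTwice {x} x∈p with x ≟ᶠ ℓ | x ≟ᶠ c
    ... | yes refl | _ = exactlyTwo-zero (edgePath-finish c~ℓ) extendAt-newEnd only-i₁
      where
      only-i₁ : ∀ i → IsEndpoint (extendAt i) ℓ → i ≡ i₁
      only-i₁ i e with extendAt-end⁻ i e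
      ... | inj₁ (i≡i₁ , _) = i≡i₁
      ... | inj₂ (e′ , _)   = ⊥-elim (Old.avoids i x∉p-x (endpoint-∈ {P = 𝒫 i} e′))
    ... | no _ | yes refl =
      exactlyTwo-zero (edgePath-start c~ℓ) (extendAt-end⁺ i₂ end₂ (i₁≢i₂ ∘ sym ∘ proj₁)) only-i₂
      where
      only-i₂ : ∀ i → IsEndpoint (extendAt i) c → i ≡ i₂
      only-i₂ i e with extendAt-end⁻ i e
      ... | inj₁ (_ , c≡ℓ) = ⊥-elim (c≢ℓ c≡ℓ)
      ... | inj₂ (e′ , ¬i₁) with ends-c i e′
      ...   | inj₁ i≡i₁ = ⊥-elim (¬i₁ (i≡i₁ , refl))
      ...   | inj₂ i≡i₂ = i≡i₂
    ... | no x≢ℓ | no x≢c =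
      exactlyTwo-suc (Sum.[ x≢c , x≢ℓ ] ∘ edgePath-end⁻ c~ℓ)
        (exactlyTwo-resp (λ i e → extendAt-end⁺ i e (x≢c ∘ proj₂)) old-end
          (Old.endTwice (x∈p∧x≢y⇒x∈p-y x∈p x≢ℓ)))
      where
      old-end : ∀ i → IsEndpoint (extendAt i) x → IsEndpoint (𝒫 i) x
      old-end i e with extendAt-end⁻ i e
      ... | inj₁ (_ , x≡ℓ) = ⊥-elim (x≢ℓ x≡ℓ)
      ... | inj₂ (e′ , _)  = e′

    separates : ∀ {x y x′ y′} → InducedEdge p x y → InducedEdge p x′ y′ → ¬ SameEdge x y x′ y′ →
                ∃ λ i → EdgeIn (family i) x y × ¬ EdgeIn (family i) x′ y′
    separates e f e≢f with classify e | classify f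
    ... | inj₁ se | _ = zero , edgePath-separates c~ℓ se e≢f
    ... | inj₂ old-e | inj₂ old-f with Old.separates old-e old-f e≢f
    ...   | i , eᵢ , ¬fᵢ = suc i , extendAt-edge⁺ i eᵢ , ¬fᵢ ∘ old-edge⁻ old-f i
    separates e f e≢f | inj₂ old-e | inj₁ sf
      with exactlyTwo-escape (old-edgeTwice old-e) (cℓ-only sf)
    ... | i , eᵢ , ¬fᵢ = suc i , eᵢ , ¬fᵢ

    isPathSystem : IsPathSystem p family
    isPathSystem = record
      { verts⊆ = verts⊆ ; edgeTwice = edgeTwice ; endTwice = endTwice ; separates = separates }

  module IsolatedEdge {p : Subset N} {u v : V} (uv : InducedEdge p u v)
                      (only-u : OnlyNeighbour p u v) (only-v : OnlyNeighbour p v u)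
                      {m : ℕ} {𝒫 : Fin m → Path G} (sys : IsPathSystem (p - u - v) 𝒫) where

    private
      module Old = IsPathSystem sys
      u~v = proj₂ (proj₂ uv)
      P₀ = edgePath u~v

    family : Fin (suc (suc m)) → Path G
    family = P₀ Vector.∷ P₀ Vector.∷ 𝒫

    private
      classify : ∀ {x y} → InducedEdge p x y → SameEdge x y u v ⊎ InducedEdge (p - u - v) x y
      classify e with inducedEdge-split u e
      ... | inj₁ (inj₁ refl) = inj₁ (inj₁ (refl , only-u e))
      ... | inj₁ (inj₂ refl) = inj₁ (inj₂ (only-u (inducedEdge-sym e) , refl))
      ... | inj₂ e′ with inducedEdge-split v e′
      ...   | inj₁ (inj₁ refl) = inj₁ (inj₂ (refl , only-v (inducedEdge-⊆ (p─q⊆p _ _) e′)))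
      ...   | inj₁ (inj₂ refl) =
        inj₁ (inj₁ (only-v (inducedEdge-⊆ (p─q⊆p _ _) (inducedEdge-sym e′)) , refl))
      ...   | inj₂ old         = inj₂ old

      new∉old : ∀ {x y} → SameEdge x y u v → ∀ i → ¬ EdgeIn (𝒫 i) x y
      new∉old se i = uncurry (sameEdge-∉ se) ∘ Old.edge⊆ i

      old∉P₀ : ∀ {x y} → InducedEdge (p - u - v) x y → ¬ EdgeIn P₀ x y
      old∉P₀ (x∈ , y∈ , _) e₀ = sameEdge-∉ (edgePath-edge⁻ u~v e₀) x∈ y∈

      u∉old : ∀ i → ¬ u ∈ˡ verts (𝒫 i)
      u∉old i = Old.avoids i (x∉p-x ∘ p─q⊆p _ _)

      P₀⊆p : ∀ {x} → x ∈ˡ verts P₀ → x ∈ p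
      P₀⊆p x∈ with edgePath-verts⁻ u~v x∈
      ... | inj₁ refl = proj₁ uv
      ... | inj₂ refl = proj₁ (proj₂ uv)

    verts⊆ : ∀ i {x} → x ∈ˡ verts (family i) → x ∈ p
    verts⊆ zero          = P₀⊆p
    verts⊆ (suc zero)    = P₀⊆p
    verts⊆ (suc (suc i)) = p─q⊆p _ _ ∘ p─q⊆p _ _ ∘ Old.verts⊆ i

    edgeTwice : ∀ {x y} → InducedEdge p x y → ExactlyTwo (λ i → EdgeIn (family i) x y)
    edgeTwice e with classify e
    ... | inj₁ se = exactlyTwo-zero e₀ e₀ λ where
            zero    _  → refl
            (suc i) eᵢ → ⊥-elim (new∉old se i eᵢ)
      where e₀ = edgeIn-resp {P = P₀} se (edgePath-edge u~v)
    ... | inj₂ old = exactlyTwo-suc (old∉P₀ old) (exactlyTwo-suc (old∉P₀ old) (Old.edgeTwice old))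

    endTwice : ∀ {x} → x ∈ p → ExactlyTwo (λ i → IsEndpoint (family i) x)
    endTwice {x} x∈p with x ≟ᶠ u | x ≟ᶠ v
    ... | yes refl | _ = exactlyTwo-zero (edgePath-start u~v) (edgePath-start u~v) λ where
            zero    _  → refl
            (suc i) eᵢ → ⊥-elim (u∉old i (endpoint-∈ {P = 𝒫 i} eᵢ))
    ... | no _ | yes refl = exactlyTwo-zero (edgePath-finish u~v) (edgePath-finish u~v) λ where
            zero    _  → refl
            (suc i) eᵢ → ⊥-elim (Old.avoids i x∉p-x (endpoint-∈ {P = 𝒫 i} eᵢ))
    ... | no x≢u | no x≢v = exactlyTwo-suc ¬end₀ (exactlyTwo-suc ¬end₀ (Old.endTwice x∈p-u-v))
      where
      ¬end₀ = Sum.[ x≢u , x≢v ] ∘ edgePath-end⁻ u~v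
      x∈p-u-v = x∈p∧x≢y⇒x∈p-y (x∈p∧x≢y⇒x∈p-y x∈p x≢u) x≢v

    separates : ∀ {x y x′ y′} → InducedEdge p x y → InducedEdge p x′ y′ → ¬ SameEdge x y x′ y′ →
                ∃ λ i → EdgeIn (family i) x y × ¬ EdgeIn (family i) x′ y′
    separates e f e≢f with classify e | classify f
    ... | inj₁ se | _ = zero , edgePath-separates u~v se e≢f
    ... | inj₂ old-e | inj₂ old-f with Old.separates old-e old-f e≢f
    ...   | i , eᵢ , ¬fᵢ = suc (suc i) , eᵢ , ¬fᵢ
    separates e f e≢f | inj₂ old-e | inj₁ sf with Old.edgeTwice old-e
    ... | i , _ , _ , eᵢ , _ = suc (suc i) , eᵢ , new∉old sf i

    isPathSystem : IsPathSystem p family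
    isPathSystem = record
      { verts⊆ = verts⊆ ; edgeTwice = edgeTwice ; endTwice = endTwice ; separates = separates }

  module Suppress {p : Subset N} {v a b : V}
                  (va : InducedEdge p v a) (vb : InducedEdge p v b) (a≢b : a ≢ b)
                  (nbrs-v : ∀ {y} → InducedEdge p v y → y ≡ a ⊎ y ≡ b)
                  {m : ℕ} {𝒫 : Fin m → Path G} (sys : IsPathSystem (p - v) 𝒫)
                  {ia ia′ : Fin m} (ia≢ia′ : ia ≢ ia′)
                  (end-ia : IsEndpoint (𝒫 ia) a) (end-ia′ : IsEndpoint (𝒫 ia′) a)
                  (ends-a : ∀ i → IsEndpoint (𝒫 i) a → i ≡ ia ⊎ i ≡ ia′)
                  {ib ib′ : Fin m} (ib≢ia : ib ≢ ia) (ib≢ib′ : ib ≢ ib′)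
                  (end-ib : IsEndpoint (𝒫 ib) b) (end-ib′ : IsEndpoint (𝒫 ib′) b)
                  (ends-b : ∀ i → IsEndpoint (𝒫 i) b → i ≡ ib ⊎ i ≡ ib′) where

    private
      module Old = IsPathSystem sys
      v∈p = proj₁ va
      a∈p = proj₁ (proj₂ va)
      b∈p = proj₁ (proj₂ vb)
      v~a = proj₂ (proj₂ va)
      v~b = proj₂ (proj₂ vb)
      a~v = ~-sym v~a

      module E₁ = ExtendAt 𝒫 ia end-ia a~v (Old.avoids ia x∉p-x)

      v∉E₁ib : ¬ v ∈ˡ verts (E₁.extendAt ib)
      v∉E₁ib v∈ with E₁.extendAt-verts⁻ ib v∈
      ... | inj₁ (ib≡ia , _) = ib≢ia ib≡ia
      ... | inj₂ v∈𝒫ib        = Old.avoids ib x∉p-x v∈𝒫ib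

      module E₂ = ExtendAt E₁.extendAt ib (E₁.extendAt-end⁺ ib end-ib (ib≢ia ∘ proj₁))
                           (~-sym v~b) v∉E₁ib

      P₀ = twoEdgePath a~v v~b a≢b
      extended = E₂.extendAt

    family : Fin (suc m) → Path G
    family = P₀ Vector.∷ extended

    private
      classify : ∀ {x y} → InducedEdge p x y →
                 SameEdge x y a v ⊎ SameEdge x y b v ⊎ InducedEdge (p - v) x y
      classify e with inducedEdge-split v e
      ... | inj₂ old = inj₂ (inj₂ old)
      ... | inj₁ (inj₁ refl) with nbrs-v e
      ...   | inj₁ y≡a = inj₁ (inj₂ (refl , y≡a))
      ...   | inj₂ y≡b = inj₂ (inj₁ (inj₂ (refl , y≡b)))
      classify e | inj₁ (inj₂ refl) with nbrs-v (inducedEdge-sym e)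
      ...   | inj₁ x≡a = inj₁ (inj₁ (x≡a , refl))
      ...   | inj₂ x≡b = inj₂ (inj₁ (inj₁ (x≡b , refl)))

      av≢bv : ∀ {x y} → SameEdge x y a v → ¬ SameEdge x y b v
      av≢bv (inj₁ (refl , refl)) (inj₁ (a≡b , _)) = a≢b a≡b
      av≢bv (inj₁ (refl , refl)) (inj₂ (a≡v , _)) = ~-irrefl a~v a≡v
      av≢bv (inj₂ (refl , refl)) (inj₁ (v≡b , _)) = ~-irrefl v~b v≡b
      av≢bv (inj₂ (refl , refl)) (inj₂ (_ , a≡b)) = a≢b a≡b

      edge⁻ : ∀ i {x y} → EdgeIn (extended i) x y →
              EdgeIn (𝒫 i) x y ⊎ (i ≡ ia × SameEdge x y a v) ⊎ (i ≡ ib × SameEdge x y b v)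
      edge⁻ i e with E₂.extendAt-edge⁻ i e
      ... | inj₂ at-ib = inj₂ (inj₂ at-ib)
      ... | inj₁ e₁    = Sum.map₂ inj₁ (E₁.extendAt-edge⁻ i e₁)

      old-edge⁺ : ∀ i {x y} → EdgeIn (𝒫 i) x y → EdgeIn (extended i) x y
      old-edge⁺ i = E₂.extendAt-edge⁺ i ∘ E₁.extendAt-edge⁺ i

      old-edge⁻ : ∀ {x y} → InducedEdge (p - v) x y →
                  ∀ i → EdgeIn (extended i) x y → EdgeIn (𝒫 i) x y
      old-edge⁻ (x∈ , y∈ , _) i e with edge⁻ i e
      ... | inj₁ e′              = e′
      ... | inj₂ (inj₁ (_ , sa)) = ⊥-elim (sameEdge-∉ sa x∈ y∈)
      ... | inj₂ (inj₂ (_ , sb)) = ⊥-elim (sameEdge-∉ sb x∈ y∈)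

      old-edgeTwice : ∀ {x y} → InducedEdge (p - v) x y →
                      ExactlyTwo (λ i → EdgeIn (extended i) x y)
      old-edgeTwice e = exactlyTwo-resp (λ i → old-edge⁺ i) (old-edge⁻ e) (Old.edgeTwice e)

      old∉P₀ : ∀ {x y} → InducedEdge (p - v) x y → ¬ EdgeIn P₀ x y
      old∉P₀ (x∈ , y∈ , _) e₀ with twoEdgePath-edge⁻ a~v v~b a≢b e₀
      ... | inj₁ sa = sameEdge-∉ sa x∈ y∈
      ... | inj₂ sb = sameEdge-∉ sb x∈ y∈

      av-only : ∀ {x y} → SameEdge x y a v → ∀ i → EdgeIn (extended i) x y → i ≡ ia
      av-only sa i e with edge⁻ i e
      ... | inj₁ e′                = ⊥-elim (uncurry (sameEdge-∉ sa) (Old.edge⊆ i e′))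
      ... | inj₂ (inj₁ (i≡ia , _)) = i≡ia
      ... | inj₂ (inj₂ (_ , sb))   = ⊥-elim (av≢bv sa sb)

      bv-only : ∀ {x y} → SameEdge x y b v → ∀ i → EdgeIn (extended i) x y → i ≡ ib
      bv-only sb i e with edge⁻ i e
      ... | inj₁ e′                = ⊥-elim (uncurry (sameEdge-∉ sb) (Old.edge⊆ i e′))
      ... | inj₂ (inj₁ (_ , sa))   = ⊥-elim (av≢bv sa sb)
      ... | inj₂ (inj₂ (i≡ib , _)) = i≡ib

      av∈P₀ : EdgeIn P₀ a v
      av∈P₀ = twoEdgePath-edgeˡ a~v v~b a≢b

      bv∈P₀ : EdgeIn P₀ b v
      bv∈P₀ = twoEdgePath-edgeʳ a~v v~b a≢b

      av∈ia : EdgeIn (extended ia) a v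
      av∈ia = E₂.extendAt-edge⁺ ia E₁.extendAt-newEdge

      bv∈ib : EdgeIn (extended ib) b v
      bv∈ib = E₂.extendAt-newEdge

      old-end⁺ : ∀ i {x} → IsEndpoint (𝒫 i) x → ¬ (i ≡ ia × x ≡ a) → ¬ (i ≡ ib × x ≡ b) →
                 IsEndpoint (extended i) x
      old-end⁺ i e ¬ia ¬ib = E₂.extendAt-end⁺ i (E₁.extendAt-end⁺ i e ¬ia) ¬ib

      old-end⁻ : ∀ i {x} → x ≢ v → IsEndpoint (extended i) x →
                 IsEndpoint (𝒫 i) x × ¬ (i ≡ ia × x ≡ a) × ¬ (i ≡ ib × x ≡ b)
      old-end⁻ i x≢v e with E₂.extendAt-end⁻ i e
      ... | inj₁ (_ , x≡v) = ⊥-elim (x≢v x≡v)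
      ... | inj₂ (e₁ , ¬ib) with E₁.extendAt-end⁻ i e₁
      ...   | inj₁ (_ , x≡v)  = ⊥-elim (x≢v x≡v)
      ...   | inj₂ (e′ , ¬ia) = e′ , ¬ia , ¬ib

      v-endTwice : ExactlyTwo (λ i → IsEndpoint (extended i) v)
      v-endTwice = ia , ib , ib≢ia ∘ sym
                 , E₂.extendAt-end⁺ ia E₁.extendAt-newEnd (ib≢ia ∘ sym ∘ proj₁)
                 , E₂.extendAt-newEnd , only
        where
        only : ∀ i → IsEndpoint (extended i) v → i ≡ ia ⊎ i ≡ ib
        only i e with E₂.extendAt-end⁻ i e
        ... | inj₁ (i≡ib , _) = inj₂ i≡ib
        ... | inj₂ (e₁ , _) with E₁.extendAt-end⁻ i e₁
        ...   | inj₁ (i≡ia , _) = inj₁ i≡ia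
        ...   | inj₂ (e′ , _)   = ⊥-elim (Old.avoids i x∉p-x (endpoint-∈ {P = 𝒫 i} e′))

    verts⊆ : ∀ i {x} → x ∈ˡ verts (family i) → x ∈ p
    verts⊆ zero x∈ with twoEdgePath-verts⁻ a~v v~b a≢b x∈
    ... | inj₁ refl        = a∈p
    ... | inj₂ (inj₁ refl) = v∈p
    ... | inj₂ (inj₂ refl) = b∈p
    verts⊆ (suc i) x∈ with E₂.extendAt-verts⁻ i x∈
    ... | inj₁ (_ , refl) = v∈p
    ... | inj₂ x∈E₁ with E₁.extendAt-verts⁻ i x∈E₁
    ...   | inj₁ (_ , refl) = v∈p
    ...   | inj₂ x∈𝒫ᵢ       = p─q⊆p p _ (Old.verts⊆ i x∈𝒫ᵢ)

    edgeTwice : ∀ {x y} → InducedEdge p x y → ExactlyTwo (λ i → EdgeIn (family i) x y)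
    edgeTwice e with classify e
    ... | inj₁ sa = exactlyTwo-zero (edgeIn-resp {P = P₀} sa av∈P₀)
                                    (edgeIn-resp {P = extended ia} sa av∈ia) (av-only sa)
    ... | inj₂ (inj₁ sb) = exactlyTwo-zero (edgeIn-resp {P = P₀} sb bv∈P₀)
                                           (edgeIn-resp {P = extended ib} sb bv∈ib) (bv-only sb)
    ... | inj₂ (inj₂ old) = exactlyTwo-suc (old∉P₀ old) (old-edgeTwice old)

    endTwice : ∀ {x} → x ∈ p → ExactlyTwo (λ i → IsEndpoint (family i) x)
    endTwice {x} x∈p with x ≟ᶠ v | x ≟ᶠ a | x ≟ᶠ b
    ... | yes refl | _ | _ =
      exactlyTwo-suc (Sum.[ ~-irrefl v~a , ~-irrefl v~b ] ∘ twoEdgePath-end⁻ a~v v~b a≢b) v-endTwice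
    ... | no x≢v | yes refl | _ =
      exactlyTwo-zero (twoEdgePath-start a~v v~b a≢b)
                      (old-end⁺ ia′ end-ia′ (ia≢ia′ ∘ sym ∘ proj₁) (a≢b ∘ proj₂)) only
      where
      only : ∀ i → IsEndpoint (extended i) a → i ≡ ia′
      only i e with old-end⁻ i x≢v e
      ... | e′ , ¬ia , _ with ends-a i e′
      ...   | inj₁ i≡ia  = ⊥-elim (¬ia (i≡ia , refl))
      ...   | inj₂ i≡ia′ = i≡ia′
    ... | no x≢v | no _ | yes refl =
      exactlyTwo-zero (twoEdgePath-finish a~v v~b a≢b)
                      (old-end⁺ ib′ end-ib′ (a≢b ∘ sym ∘ proj₂) (ib≢ib′ ∘ sym ∘ proj₁)) only
      where
      only : ∀ i → IsEndpoint (extended i) b → i ≡ ib′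
      only i e with old-end⁻ i x≢v e
      ... | e′ , _ , ¬ib with ends-b i e′
      ...   | inj₁ i≡ib  = ⊥-elim (¬ib (i≡ib , refl))
      ...   | inj₂ i≡ib′ = i≡ib′
    ... | no x≢v | no x≢a | no x≢b =
      exactlyTwo-suc (Sum.[ x≢a , x≢b ] ∘ twoEdgePath-end⁻ a~v v~b a≢b)
        (exactlyTwo-resp (λ i e → old-end⁺ i e (x≢a ∘ proj₂) (x≢b ∘ proj₂))
                         (λ i → proj₁ ∘ old-end⁻ i x≢v)
                         (Old.endTwice (x∈p∧x≢y⇒x∈p-y x∈p x≢v)))

    separates : ∀ {x y x′ y′} → InducedEdge p x y → InducedEdge p x′ y′ → ¬ SameEdge x y x′ y′ →
                ∃ λ i → EdgeIn (family i) x y × ¬ EdgeIn (family i) x′ y′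
    separates e f e≢f with classify e | classify f
    ... | inj₁ sa | inj₁ sa′ = ⊥-elim (e≢f (sameEdge-trans sa sa′))
    ... | inj₁ sa | inj₂ (inj₁ sb) =
      suc ia , edgeIn-resp {P = extended ia} sa av∈ia , λ fᵢ → ib≢ia (sym (bv-only sb ia fᵢ))
    ... | inj₁ sa | inj₂ (inj₂ old) = zero , edgeIn-resp {P = P₀} sa av∈P₀ , old∉P₀ old
    ... | inj₂ (inj₁ sb) | inj₂ (inj₁ sb′) = ⊥-elim (e≢f (sameEdge-trans sb sb′))
    ... | inj₂ (inj₁ sb) | inj₁ sa =
      suc ib , edgeIn-resp {P = extended ib} sb bv∈ib , λ fᵢ → ib≢ia (av-only sa ib fᵢ)
    ... | inj₂ (inj₁ sb) | inj₂ (inj₂ old) = zero , edgeIn-resp {P = P₀} sb bv∈P₀ , old∉P₀ old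
    ... | inj₂ (inj₂ old-e) | inj₁ sa with exactlyTwo-escape (old-edgeTwice old-e) (av-only sa)
    ...   | i , eᵢ , ¬fᵢ = suc i , eᵢ , ¬fᵢ
    separates e f e≢f | inj₂ (inj₂ old-e) | inj₂ (inj₁ sb)
      with exactlyTwo-escape (old-edgeTwice old-e) (bv-only sb)
    ... | i , eᵢ , ¬fᵢ = suc i , eᵢ , ¬fᵢ
    separates e f e≢f | inj₂ (inj₂ old-e) | inj₂ (inj₂ old-f) with Old.separates old-e old-f e≢f
    ... | i , eᵢ , ¬fᵢ = suc i , old-edge⁺ i eᵢ , ¬fᵢ ∘ old-edge⁻ old-f i

    isPathSystem : IsPathSystem p family
    isPathSystem = record
      { verts⊆ = verts⊆ ; edgeTwice = edgeTwice ; endTwice = endTwice ; separates = separates }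

  attachPendant : ∀ {p c ℓ m} → InducedEdge p c ℓ → OnlyNeighbour p ℓ c →
                  PathSystem (p - ℓ) m → PathSystem p (suc m)
  attachPendant cℓ@(c∈p , _ , c~ℓ) only-ℓ (𝒫 , sys)
    with i₁ , i₂ , i₁≢i₂ , end₁ , end₂ , ends-c ←
           IsPathSystem.endTwice sys (x∈p∧x≢y⇒x∈p-y c∈p (~-irrefl c~ℓ))
    = family , isPathSystem
    where open Pendant cℓ only-ℓ sys i₁≢i₂ end₁ end₂ ends-c

  addIsolatedEdge : ∀ {p u v m} → InducedEdge p u v → OnlyNeighbour p u v → OnlyNeighbour p v u →
                    PathSystem (p - u - v) m → PathSystem p (suc (suc m))
  addIsolatedEdge uv only-u only-v (𝒫 , sys) = family , isPathSystem
    where open IsolatedEdge uv only-u only-v sys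

  suppress : ∀ {p v a b m} → InducedEdge p v a → InducedEdge p v b → a ≢ b →
             (∀ {y} → InducedEdge p v y → y ≡ a ⊎ y ≡ b) →
             PathSystem (p - v) m → PathSystem p (suc m)
  suppress va@(_ , a∈p , v~a) vb@(_ , b∈p , v~b) a≢b nbrs-v (𝒫 , sys)
    with ia , ia′ , ia≢ia′ , end-ia , end-ia′ , ends-a ←
           IsPathSystem.endTwice sys (x∈p∧x≢y⇒x∈p-y a∈p (~-irrefl v~a ∘ sym))
    -- the path extended by av may end at b, so bv must extend a different one
    with (ib , ib′ , ib≢ib′ , end-ib , end-ib′ , ends-b) , ib≢ia ←
           exactlyTwo-avoiding ia
             (IsPathSystem.endTwice sys (x∈p∧x≢y⇒x∈p-y b∈p (~-irrefl v~b ∘ sym)))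
    = family , isPathSystem
    where open Suppress va vb a≢b nbrs-v sys ia≢ia′ end-ia end-ia′ ends-a
                        ib≢ia ib≢ib′ end-ib end-ib′ ends-b

  pathSystem : TwoDegenerate G → ∀ p → NoIsolated p → PathSystem p ∣ p ∣
  pathSystem twoDeg = All.wfRec ⊂-wellFounded _ Motive build
    where
    Motive : Subset N → Set
    Motive p = NoIsolated p → PathSystem p ∣ p ∣

    build : ∀ p → WfRec _⊂_ Motive p → Motive p
    build p rec noIso = case nonempty? p of λ where
        (no empty)      → resize (trans (cong ∣_∣ (Empty-unique empty)) (∣⊥∣≡0 N)) (noPaths empty)
        (yes (_ , x∈p)) → let _ , v∈p , nbrs = lowDegreeVertex twoDeg x∈p
                          in reduce (reducible noIso v∈p nbrs)
      where
      resize : ∀ {m} → ∣ p ∣ ≡ m → PathSystem p m → PathSystem p ∣ p ∣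
      resize eq = subst (PathSystem p) (sym eq)

      reduce : Reducible p → PathSystem p ∣ p ∣
      reduce (pendant cℓ@(_ , ℓ∈p , _) only-ℓ other) =
        resize (x∈p⇒∣p∣≡1+∣p-x∣ ℓ∈p) (attachPendant cℓ only-ℓ
          (rec (x∈p⇒p-x⊂p ℓ∈p) (noIsolated-pendant noIso only-ℓ other)))
      reduce (isolatedEdge uv@(u∈p , v∈p , u~v) only-u only-v) =
        resize (trans (x∈p⇒∣p∣≡1+∣p-x∣ u∈p) (cong suc (x∈p⇒∣p∣≡1+∣p-x∣ v∈p-u)))
          (addIsolatedEdge uv only-u only-v
            (rec p-u-v⊂p (noIsolated-isolatedEdge noIso only-u only-v)))
        where
        v∈p-u = x∈p∧x≢y⇒x∈p-y v∈p (~-irrefl u~v ∘ sym)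
        p-u-v⊂p = ⊂-trans (x∈p⇒p-x⊂p v∈p-u) (x∈p⇒p-x⊂p u∈p)
      reduce (suppressible va@(v∈p , _) vb a≢b nbrs-v oa ob) =
        resize (x∈p⇒∣p∣≡1+∣p-x∣ v∈p) (suppress va vb a≢b nbrs-v
          (rec (x∈p⇒p-x⊂p v∈p) (noIsolated-suppress noIso nbrs-v oa ob)))

  noIsolated-⊤ : Connected G → (∀ x → ∃ λ y → x ≢ y) → NoIsolated ⊤
  noIsolated-⊤ connected another {x} _ with another x
  ... | y , x≢y with connected x y
  ...   | stay       = ⊥-elim (x≢y refl)
  ...   | step x~w _ = _ , ∈⊤ , ∈⊤ , x~w

another : ∀ {k} (x : Fin (suc (suc k))) → ∃ λ y → x ≢ y
another zero    = suc zero , λ ()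
another (suc _) = zero , λ ()

theorem2p1 : (n : ℕ) → 3 ≤ n → (G : SimpleGraph n) →
    Connected G → TwoDegenerate G →
    Σ (Fin n → Path G) λ 𝒫 →
      StronglySeparating G 𝒫 × EveryEdgeInExactlyTwo G 𝒫 × EveryVertexEndOfExactlyTwo G 𝒫
theorem2p1 n@(suc (suc _)) (s≤s (s≤s _)) G connected twoDeg
  with 𝒫 , sys ← subst (PathSystem G ⊤) (∣⊤∣≡n n)
                   (pathSystem G twoDeg ⊤ (noIsolated-⊤ G connected another))
  = 𝒫 , separating , (λ u v u~v → edgeTwice (∈⊤ , ∈⊤ , u~v)) , (λ v → endTwice ∈⊤)
  where
  open IsPathSystem sys
  separating : StronglySeparating G 𝒫
  separating u v u′ v′ u~v u′~v′ e≢f =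
    separates (∈⊤ , ∈⊤ , u~v) (∈⊤ , ∈⊤ , u′~v′) e≢f ,
    separates (∈⊤ , ∈⊤ , u′~v′) (∈⊤ , ∈⊤ , u~v) (e≢f ∘ sameEdge-sym)
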